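{- Let $T$ be a tree with $n\ge 4$ nodes and maximal degree $\Delta\ge n-\lceil n/3\rceil$. Then $|E_{fix}(T)|\le 2^{n-\Delta-1}$. Moreover this bound is sharp: for every $n\ge 4$ and every $\Delta$ with $n-\lceil n/3\rceil\le\Delta\le n-1$ there is a tree with $n$ nodes and maximal degree $\Delta$ for which equality holds.
   Context: For a tree $T=(V,E)$, $E_{fix}(T)$ is the set of all $F\subseteq E$ with $2deg_F(v)\le deg(v)$ for every $v\in V$, where $deg_F(v)$ is the number of edges of $F$ incident to $v$ and $deg(v)$ is the degree of $v$ in $T$. -}

module Defs where

open import Data.Nat using (ℕ; zero; suc; _+_; _*_; _∸_; _≤_; _<_; _≤?_; _/_)
open import Data.Nat.Properties using ()
open import Data.Bool using (Bool; true; false; if_then_else_; _∨_)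
open import Data.Fin using (Fin) renaming (_<_ to _<ᶠ_)
open import Data.Fin.Properties using (_≟_; all?)
open import Data.Product using (_×_; _,_; proj₁; proj₂; Σ; ∃)
open import Data.List using (List; []; _∷_; length; filter; map; _++_)
open import Data.List.Relation.Unary.All using (All)
open import Data.List.Relation.Unary.Unique.Propositional using (Unique)
open import Data.List.Membership.Propositional using (_∈_)
open import Data.Vec using (Vec; []; _∷_)
open import Data.Sum using (_⊎_)
open import Relation.Nullary using (Dec; yes; no; does)
open import Relation.Binary.PropositionalEquality using (_≡_)
open import Relation.Binary.Construct.Closure.ReflexiveTransitive using (Star)

-- A simple graph on the vertex set Fin n, given by its edge list.
-- Each edge {u,v} is stored once, as an ordered pair (u , v) with u < v.
Edge : ℕ → Set
Edge n = Fin n × Fin n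

record Graph (n : ℕ) : Set where
  field
    edges    : List (Edge n)
    ordered  : All (λ e → proj₁ e <ᶠ proj₂ e) edges
    distinct : Unique edges
open Graph public

incident : ∀ {n} → Fin n → Edge n → Bool
incident v (a , b) = does (v ≟ a) ∨ does (v ≟ b)

degIn : ∀ {n} → List (Edge n) → Fin n → ℕ
degIn [] v = 0
degIn (e ∷ F) v = if incident v e then suc (degIn F v) else degIn F v

deg : ∀ {n} → Graph n → Fin n → ℕ
deg G v = degIn (edges G) v

Adj : ∀ {n} → Graph n → Fin n → Fin n → Set
Adj G u v = ((u , v) ∈ edges G) ⊎ ((v , u) ∈ edges G)

Connected : ∀ {n} → Graph n → Set
Connected {n} G = (u v : Fin n) → Star (Adj G) u v

-- A tree on n ≥ 1 vertices: a connected graph with exactly n - 1 edges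
-- (equivalently: connected and acyclic).
IsTree : ∀ {n} → Graph n → Set
IsTree {n} G = Connected G × (length (edges G) ≡ n ∸ 1)

IsMaxDegree : ∀ {n} → Graph n → ℕ → Set
IsMaxDegree {n} G Δ = ((v : Fin n) → deg G v ≤ Δ) × ∃ (λ v → deg G v ≡ Δ)

-- Subsets of a list, encoded by a characteristic Bool vector.
select : ∀ {A : Set} (xs : List A) → Vec Bool (length xs) → List A
select [] [] = []
select (x ∷ xs) (true ∷ bs) = x ∷ select xs bs
select (x ∷ xs) (false ∷ bs) = select xs bs

allMasks : (k : ℕ) → List (Vec Bool k)
allMasks zero = [] ∷ []
allMasks (suc k) = map (true ∷_) (allMasks k) ++ map (false ∷_) (allMasks k)

IsFix : ∀ {n} → (G : Graph n) → List (Edge n) → Set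
IsFix {n} G F = (v : Fin n) → 2 * degIn F v ≤ deg G v

isFix? : ∀ {n} (G : Graph n) (F : List (Edge n)) → Dec (IsFix G F)
isFix? G F = all? (λ v → 2 * degIn F v ≤? deg G v)

numFix : ∀ {n} → Graph n → ℕ
numFix G = length (filter (λ m → isFix? G (select (edges G) m)) (allMasks (length (edges G))))

ceil3 : ℕ → ℕ
ceil3 n = (n + 2) / 3

-- A set F in E_fix contains no edge at a leaf v, since 2 deg_F(v) ≤ 1 forces deg_F(v) = 0.
-- In a tree on at least three vertices no edge joins two leaves, so at least #leaves edges
-- are excluded, and #leaves ≥ Δ: the vertex degrees sum to 2(n - 1) and each is ≥ 1, so
-- Σ (deg v + [v is a leaf]) ≥ 2n + (Δ - 2) forces #leaves ≥ Δ.  Hence |E_fix| ≤ 2^(n - 1 - Δ).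
-- For sharpness take the spider whose centre has Δ neighbours, k = n - 1 - Δ of which carry one
-- further pendant vertex.  The bound Δ ≥ n - ⌈n/3⌉ gives 2k ≤ Δ, so every subset of the k
-- edges from the centre to the middle vertices of the legs lies in E_fix.
module Submission where

open import Defs
open import Data.Nat using (ℕ; zero; suc; _+_; _*_; _∸_; _^_; _≤_; _<_; z≤n; s≤s)
import Data.Nat as ℕ
open import Data.Nat.Properties hiding (_≟_)
open import Data.Nat.Tactic.RingSolver using (solve-∀)
open import Data.Nat.DivMod using (m/n*n≤m)
open import Data.Bool using (Bool; true; false)
open import Data.Fin as Fin using (Fin; zero; suc)
open import Data.Fin.Properties using (_≟_) renaming (<⇒≢ to <ᶠ⇒≢)
open import Data.Product using (_×_; _,_; proj₁; proj₂; Σ; ∃)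
open import Data.Sum using (_⊎_; inj₁; inj₂)
open import Data.Empty using (⊥; ⊥-elim)
open import Data.List using (List; []; _∷_; length; filter; map; _++_)
open import Data.List.Properties
  using (length-++; length-map; length-filter; filter-++; filter-accept; filter-none)
open import Data.List.Relation.Unary.All as All using (All; []; _∷_)
import Data.List.Relation.Unary.All.Properties as Allₚ
import Data.List.Relation.Unary.Unique.Propositional.Properties as Uniqueₚ
open import Data.List.Relation.Unary.AllPairs using ([]; _∷_)
open import Data.List.Relation.Unary.Any using (here; there)
open import Data.List.Membership.Propositional using (_∈_)
open import Data.List.Membership.Propositional.Properties using (∈-map⁺)
open import Data.List.Relation.Binary.Sublist.Propositional using (_⊆_; []; _∷_; _∷ʳ_; minimum)
import Data.List.Relation.Binary.Sublist.Propositional.Properties as Sublistₚ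
open import Data.Vec using (Vec; []; _∷_)
open import Relation.Nullary using (Dec; yes; no; does; ¬_; _⊎-dec_; contradiction)
open import Relation.Nullary.Decidable using (dec-true; dec-false)
open import Relation.Unary.Properties using (∁?)
open import Relation.Binary.PropositionalEquality
open import Relation.Binary.Construct.Closure.ReflexiveTransitive as Star using (Star; ε; _◅_)
open import Algebra.Properties.CommutativeMonoid.Sum +-0-commutativeMonoid
  using (sum-syntax; sum-cong-≗; sum-replicate-zero; ∑-distrib-+)

indicator : Bool → ℕ
indicator true  = 1
indicator false = 0

∑-delta : ∀ {n} (w : Fin n → ℕ) (a : Fin n) → ∑[ v < n ] (w v * indicator (does (v ≟ a))) ≡ w a
∑-delta {suc n} w zero = begin
  w zero * 1 + ∑[ v < n ] (w (suc v) * 0)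
    ≡⟨ cong₂ _+_ (*-identityʳ (w zero))
                 (trans (sum-cong-≗ (λ v → *-zeroʳ (w (suc v)))) (sum-replicate-zero n)) ⟩
  w zero + 0
    ≡⟨ +-identityʳ (w zero) ⟩
  w zero ∎
  where open ≡-Reasoning
∑-delta {suc n} w (suc a) =
  trans (cong (_+ ∑[ v < n ] (w (suc v) * indicator (does (v ≟ a)))) (*-zeroʳ (w zero)))
        (∑-delta (λ v → w (suc v)) a)

∑-≥-peak : ∀ {n} (f : Fin n → ℕ) {k d} (v₀ : Fin n) →
  (∀ v → k ≤ f v) → k + d ≤ f v₀ → n * k + d ≤ ∑[ v < n ] f v
∑-≥-peak {suc n} f {k} {d} zero low peak = begin
  (k + n * k) + d ≡⟨ +-assoc k (n * k) d ⟩
  k + (n * k + d) ≡⟨ cong (k +_) (+-comm (n * k) d) ⟩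
  k + (d + n * k) ≡⟨ +-assoc k d (n * k) ⟨
  (k + d) + n * k ≤⟨ +-mono-≤ peak (∑-≥-const n (λ v → low (suc v))) ⟩
  f zero + ∑[ v < n ] f (suc v) ∎
  where
  open ≤-Reasoning
  ∑-≥-const : ∀ m {g : Fin m → ℕ} → (∀ v → k ≤ g v) → m * k ≤ ∑[ v < m ] g v
  ∑-≥-const zero    low = z≤n
  ∑-≥-const (suc m) low = +-mono-≤ (low zero) (∑-≥-const m (λ v → low (suc v)))
∑-≥-peak {suc n} f {k} {d} (suc v₀) low peak = begin
  (k + n * k) + d ≡⟨ +-assoc k (n * k) d ⟩
  k + (n * k + d)
    ≤⟨ +-mono-≤ (low zero) (∑-≥-peak (λ v → f (suc v)) v₀ (λ v → low (suc v)) peak) ⟩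
  f zero + ∑[ v < n ] f (suc v) ∎
  where open ≤-Reasoning

degIn-∷ : ∀ {n} e (E : List (Edge n)) v → degIn (e ∷ E) v ≡ indicator (incident v e) + degIn E v
degIn-∷ e E v with incident v e
... | true  = refl
... | false = refl

incident-≢ : ∀ {n} {a b : Fin n} (v : Fin n) → a ≢ b →
  indicator (incident v (a , b)) ≡ indicator (does (v ≟ a)) + indicator (does (v ≟ b))
incident-≢ {a = a} {b} v a≢b with v ≟ a | v ≟ b
... | yes refl | yes refl = contradiction refl a≢b
... | yes _    | no _     = refl
... | no _     | yes _    = refl
... | no _     | no _     = refl

incident-left : ∀ {n} (a b : Fin n) → incident a (a , b) ≡ true
incident-left a b with a ≟ a
... | yes _  = refl
... | no a≢a = contradiction refl a≢a

incident-right : ∀ {n} (a b : Fin n) → incident b (a , b) ≡ true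
incident-right a b with b ≟ a | b ≟ b
... | yes _ | _      = refl
... | no _  | yes _  = refl
... | no _  | no b≢b = contradiction refl b≢b

edgeWeight : ∀ {n} → (Fin n → ℕ) → List (Edge n) → ℕ
edgeWeight w []            = 0
edgeWeight w ((a , b) ∷ E) = (w a + w b) + edgeWeight w E

handshake : ∀ {n} (w : Fin n → ℕ) (E : List (Edge n)) → All (λ e → proj₁ e ≢ proj₂ e) E →
  ∑[ v < n ] (w v * degIn E v) ≡ edgeWeight w E
handshake {n} w [] [] = trans (sum-cong-≗ (λ v → *-zeroʳ (w v))) (sum-replicate-zero n)
handshake {n} w ((a , b) ∷ E) (a≢b ∷ loopless) = begin
  ∑[ v < n ] (w v * degIn ((a , b) ∷ E) v)
    ≡⟨ sum-cong-≗ split ⟩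
  ∑[ v < n ] ((w v * δ a v + w v * δ b v) + w v * degIn E v)
    ≡⟨ ∑-distrib-+ (λ v → w v * δ a v + w v * δ b v) (λ v → w v * degIn E v) ⟩
  ∑[ v < n ] (w v * δ a v + w v * δ b v) + ∑[ v < n ] (w v * degIn E v)
    ≡⟨ cong₂ _+_ (trans (∑-distrib-+ (λ v → w v * δ a v) (λ v → w v * δ b v))
                        (cong₂ _+_ (∑-delta w a) (∑-delta w b)))
                 (handshake w E loopless) ⟩
  (w a + w b) + edgeWeight w E ∎
  where
  open ≡-Reasoning
  δ : Fin n → Fin n → ℕ
  δ x v = indicator (does (v ≟ x))
  split : ∀ v → w v * degIn ((a , b) ∷ E) v ≡ (w v * δ a v + w v * δ b v) + w v * degIn E v
  split v = begin
    w v * degIn ((a , b) ∷ E) v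
      ≡⟨ cong (w v *_) (trans (degIn-∷ (a , b) E v) (cong (_+ degIn E v) (incident-≢ v a≢b))) ⟩
    w v * ((δ a v + δ b v) + degIn E v)
      ≡⟨ trans (*-distribˡ-+ (w v) _ _) (cong (_+ w v * degIn E v) (*-distribˡ-+ (w v) _ _)) ⟩
    (w v * δ a v + w v * δ b v) + w v * degIn E v ∎

edgeWeight-1 : ∀ {n} (E : List (Edge n)) → edgeWeight (λ _ → 1) E ≡ length E + length E
edgeWeight-1 []      = refl
edgeWeight-1 (_ ∷ E) = trans (cong (2 +_) (edgeWeight-1 E)) (cong suc (sym (+-suc (length E) (length E))))

edgeWeight-≤-count : ∀ {n} (w : Fin n → ℕ) {P : Edge n → Set} (P? : ∀ e → Dec (P e))
  (E : List (Edge n)) → All (λ e → w (proj₁ e) + w (proj₂ e) ≤ indicator (does (P? e))) E →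
  edgeWeight w E ≤ length (filter P? E)
edgeWeight-≤-count w P? [] [] = z≤n
edgeWeight-≤-count w P? ((a , b) ∷ E) (le ∷ les) with P? (a , b)
... | yes _ = +-mono-≤ le (edgeWeight-≤-count w P? E les)
... | no _  = +-mono-≤ le (edgeWeight-≤-count w P? E les)

∈⇒0<degIn : ∀ {n} {e} {E : List (Edge n)} v → e ∈ E → incident v e ≡ true → 0 < degIn E v
∈⇒0<degIn {e = e} {E = e ∷ E} v (here refl) inc rewrite degIn-∷ e E v | inc = s≤s z≤n
∈⇒0<degIn {E = f ∷ E} v (there e∈E) inc rewrite degIn-∷ f E v =
  ≤-trans (∈⇒0<degIn v e∈E inc) (m≤n+m _ _)

degIn-∷-incident : ∀ {n} {f} {E : List (Edge n)} {x} → incident x f ≡ true →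
  degIn (f ∷ E) x ≡ suc (degIn E x)
degIn-∷-incident {f = f} {E} {x} i rewrite degIn-∷ f E x | i = refl

degIn≡1⇒incident-unique : ∀ {n} {E : List (Edge n)} {x e e′} → degIn E x ≡ 1 →
  e ∈ E → e′ ∈ E → incident x e ≡ true → incident x e′ ≡ true → e ≡ e′
degIn≡1⇒incident-unique {E = _ ∷ _} _ (here refl) (here refl) _ _ = refl
degIn≡1⇒incident-unique {E = f ∷ E} {x} d (here refl) (there e′∈E) i i′ = ⊥-elim
  (<⇒≢ (∈⇒0<degIn x e′∈E i′)
        (sym (suc-injective (trans (sym (degIn-∷-incident {f = f} {E} i)) d))))
degIn≡1⇒incident-unique d (there e∈E) (here refl) i i′ =
  sym (degIn≡1⇒incident-unique d (here refl) (there e∈E) i′ i)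
degIn≡1⇒incident-unique {E = f ∷ E} {x} d (there e∈E) (there e′∈E) i i′ with incident x f
... | true  = ⊥-elim (<⇒≢ (∈⇒0<degIn x e∈E i) (sym (suc-injective d)))
... | false = degIn≡1⇒incident-unique d e∈E e′∈E i i′

Adj⇒0<deg : ∀ {n} (G : Graph n) {u v} → Adj G u v → 0 < deg G u
Adj⇒0<deg G {u} {v} (inj₁ uv∈G) = ∈⇒0<degIn u uv∈G (incident-left u v)
Adj⇒0<deg G {u} {v} (inj₂ vu∈G) = ∈⇒0<degIn u vu∈G (incident-right v u)

connected⇒0<deg : ∀ {k} (G : Graph (2 + k)) → Connected G → ∀ v → 0 < deg G v
connected⇒0<deg G conn zero with conn zero (suc zero)
... | adj ◅ _ = Adj⇒0<deg G adj
connected⇒0<deg G conn (suc v) with conn (suc v) zero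
... | adj ◅ _ = Adj⇒0<deg G adj

module _ {n} (G : Graph n) {a b : Fin n} (ab∈G : (a , b) ∈ edges G)
         (leaf-a : deg G a ≡ 1) (leaf-b : deg G b ≡ 1) where

  private
    End : Fin n → Set
    End x = x ≡ a ⊎ x ≡ b

    only-edge-at-a : ∀ {e} → e ∈ edges G → incident a e ≡ true → e ≡ (a , b)
    only-edge-at-a e∈G i = degIn≡1⇒incident-unique leaf-a e∈G ab∈G i (incident-left a b)

    only-edge-at-b : ∀ {e} → e ∈ edges G → incident b e ≡ true → e ≡ (a , b)
    only-edge-at-b e∈G i = degIn≡1⇒incident-unique leaf-b e∈G ab∈G i (incident-right a b)

    Adj-End : ∀ {x y} → Adj G x y → End x → End y
    Adj-End (inj₁ ay∈G) (inj₁ refl) = inj₂ (cong proj₂ (only-edge-at-a ay∈G (incident-left a _)))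
    Adj-End (inj₂ ya∈G) (inj₁ refl) = inj₁ (cong proj₁ (only-edge-at-a ya∈G (incident-right _ a)))
    Adj-End (inj₁ by∈G) (inj₂ refl) = inj₂ (cong proj₂ (only-edge-at-b by∈G (incident-left b _)))
    Adj-End (inj₂ yb∈G) (inj₂ refl) = inj₁ (cong proj₁ (only-edge-at-b yb∈G (incident-right _ b)))

  leafEdge-component : ∀ {y} → Star (Adj G) a y → y ≡ a ⊎ y ≡ b
  leafEdge-component = go (inj₁ refl)
    where
    go : ∀ {x y} → End x → Star (Adj G) x y → End y
    go end ε          = end
    go end (adj ◅ xy) = go (Adj-End adj end) xy

avoid-two : ∀ {k} (a b : Fin (3 + k)) → ∃ λ w → w ≢ a × w ≢ b
avoid-two a b with zero ≟ a | zero ≟ b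
... | no 0≢a | no 0≢b = zero , 0≢a , 0≢b
... | yes refl | _ with suc zero ≟ b
...   | no 1≢b   = suc zero , (λ ()) , 1≢b
...   | yes refl = suc (suc zero) , (λ ()) , (λ ())
avoid-two a b | no 0≢a | yes refl with suc zero ≟ a
...   | no 1≢a   = suc zero , 1≢a , (λ ())
...   | yes refl = suc (suc zero) , (λ ()) , (λ ())

connected⇒¬leaf-leaf : ∀ {k} (G : Graph (3 + k)) → Connected G → ∀ {a b} → (a , b) ∈ edges G →
  deg G a ≡ 1 → deg G b ≡ 1 → ⊥
connected⇒¬leaf-leaf G conn {a} {b} ab∈G leaf-a leaf-b with avoid-two a b
... | w , w≢a , w≢b with leafEdge-component G ab∈G leaf-a leaf-b (conn a w)
...   | inj₁ w≡a = w≢a w≡a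
...   | inj₂ w≡b = w≢b w≡b

isLeaf : ∀ {n} → Graph n → Fin n → Bool
isLeaf G v = does (deg G v ℕ.≟ 1)

leaves : ∀ {n} → Graph n → ℕ
leaves {n} G = ∑[ v < n ] indicator (isLeaf G v)

LeafEdge : ∀ {n} → Graph n → Edge n → Set
LeafEdge G e = deg G (proj₁ e) ≡ 1 ⊎ deg G (proj₂ e) ≡ 1

leafEdge? : ∀ {n} (G : Graph n) e → Dec (LeafEdge G e)
leafEdge? G e = (deg G (proj₁ e) ℕ.≟ 1) ⊎-dec (deg G (proj₂ e) ℕ.≟ 1)

indicator-⊎-dec : ∀ {A B : Set} (a? : Dec A) (b? : Dec B) → ¬ (A × B) →
  indicator (does a?) + indicator (does b?) ≤ indicator (does (a? ⊎-dec b?))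
indicator-⊎-dec (yes a) (yes b) ¬ab = contradiction (a , b) ¬ab
indicator-⊎-dec (yes _) (no _)  _   = ≤-refl
indicator-⊎-dec (no _)  (yes _) _   = ≤-refl
indicator-⊎-dec (no _)  (no _)  _   = ≤-refl

leaf-indicator-* : ∀ d → indicator (does (d ℕ.≟ 1)) ≡ indicator (does (d ℕ.≟ 1)) * d
leaf-indicator-* 0             = refl
leaf-indicator-* 1             = refl
leaf-indicator-* (suc (suc d)) = refl

leaf-indicator-+ : ∀ d → 0 < d → 2 + (d ∸ 2) ≤ d + indicator (does (d ℕ.≟ 1))
leaf-indicator-+ 1             _ = ≤-refl
leaf-indicator-+ (suc (suc d)) _ = m≤m+n _ _

leaves≤leafEdges : ∀ {k} (G : Graph (3 + k)) → Connected G →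
  leaves G ≤ length (filter (leafEdge? G) (edges G))
leaves≤leafEdges {k} G conn = begin
  leaves G
    ≡⟨ sum-cong-≗ (λ v → leaf-indicator-* (deg G v)) ⟩
  ∑[ v < 3 + k ] (leaf v * deg G v)
    ≡⟨ handshake leaf (edges G) (All.map <ᶠ⇒≢ (ordered G)) ⟩
  edgeWeight leaf (edges G)
    ≤⟨ edgeWeight-≤-count leaf (leafEdge? G) (edges G) (All.tabulate λ {e} e∈G →
         indicator-⊎-dec (deg G (proj₁ e) ℕ.≟ 1) (deg G (proj₂ e) ℕ.≟ 1)
                         (λ (leaf₁ , leaf₂) → connected⇒¬leaf-leaf G conn e∈G leaf₁ leaf₂)) ⟩
  length (filter (leafEdge? G) (edges G)) ∎
  where
  open ≤-Reasoning
  leaf : Fin (3 + k) → ℕ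
  leaf v = indicator (isLeaf G v)

deg≤leaves : ∀ {k} (T : Graph (2 + k)) → IsTree T → ∀ v → deg T v ≤ leaves T
deg≤leaves {k} T (conn , size) v₀ = ≤-trans (m≤n+m∸n d 2) (+-cancelˡ-≤ (suc k + suc k) _ _ (begin
  (suc k + suc k) + (2 + (d ∸ 2))
    ≡⟨ regroup k (d ∸ 2) ⟨
  (2 + k) * 2 + (d ∸ 2)
    ≤⟨ ∑-≥-peak (λ v → deg T v + leaf v) v₀
                (λ v → ≤-trans (m≤m+n 2 _) (bound v)) (bound v₀) ⟩
  ∑[ v < 2 + k ] (deg T v + leaf v)
    ≡⟨ ∑-distrib-+ (deg T) leaf ⟩
  ∑[ v < 2 + k ] deg T v + leaves T
    ≡⟨ cong (_+ leaves T) ∑deg ⟩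
  (suc k + suc k) + leaves T ∎))
  where
  open ≤-Reasoning
  d : ℕ
  d = deg T v₀
  leaf : Fin (2 + k) → ℕ
  leaf v = indicator (isLeaf T v)
  bound : ∀ v → 2 + (deg T v ∸ 2) ≤ deg T v + leaf v
  bound v = leaf-indicator-+ (deg T v) (connected⇒0<deg T conn v)
  regroup : ∀ k x → (2 + k) * 2 + x ≡ (suc k + suc k) + (2 + x)
  regroup = solve-∀
  ∑deg : ∑[ v < 2 + k ] deg T v ≡ suc k + suc k
  ∑deg = begin-equality
    ∑[ v < 2 + k ] deg T v
      ≡⟨ sum-cong-≗ (λ v → +-identityʳ (deg T v)) ⟨
    ∑[ v < 2 + k ] (1 * deg T v)
      ≡⟨ handshake (λ _ → 1) (edges T) (All.map <ᶠ⇒≢ (ordered T)) ⟩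
    edgeWeight (λ _ → 1) (edges T)
      ≡⟨ edgeWeight-1 (edges T) ⟩
    length (edges T) + length (edges T)
      ≡⟨ cong (λ l → l + l) size ⟩
    suc k + suc k ∎

countSubsets : ∀ {A : Set} {Q : List A → Set} → (∀ F → Dec (Q F)) → List A → ℕ
countSubsets Q? xs = length (filter (λ m → Q? (select xs m)) (allMasks (length xs)))

length-filter-map : ∀ {A B : Set} {P : B → Set} (P? : ∀ y → Dec (P y)) (f : A → B) (xs : List A) →
  length (filter P? (map f xs)) ≡ length (filter (λ x → P? (f x)) xs)
length-filter-map P? f []       = refl
length-filter-map P? f (x ∷ xs) with does (P? (f x))
... | true  = cong suc (length-filter-map P? f xs)
... | false = length-filter-map P? f xs

length-filter-∁ : ∀ {A : Set} {P : A → Set} (P? : ∀ x → Dec (P x)) (xs : List A) →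
  length (filter P? xs) + length (filter (∁? P?) xs) ≡ length xs
length-filter-∁ P? []       = refl
length-filter-∁ P? (x ∷ xs) with P? x
... | yes _ = cong suc (length-filter-∁ P? xs)
... | no _  = trans (+-suc _ _) (cong suc (length-filter-∁ P? xs))

countSubsets-∷ : ∀ {A : Set} {Q : List A → Set} (Q? : ∀ F → Dec (Q F)) x xs →
  countSubsets Q? (x ∷ xs) ≡ countSubsets (λ F → Q? (x ∷ F)) xs + countSubsets Q? xs
countSubsets-∷ {Q = Q} Q? x xs = begin
  length (filter R (map (true ∷_) ms ++ map (false ∷_) ms))
    ≡⟨ cong length (filter-++ R (map (true ∷_) ms) (map (false ∷_) ms)) ⟩
  length (filter R (map (true ∷_) ms) ++ filter R (map (false ∷_) ms))
    ≡⟨ length-++ (filter R (map (true ∷_) ms)) ⟩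
  length (filter R (map (true ∷_) ms)) + length (filter R (map (false ∷_) ms))
    ≡⟨ cong₂ _+_ (length-filter-map R (true ∷_) ms) (length-filter-map R (false ∷_) ms) ⟩
  countSubsets (λ F → Q? (x ∷ F)) xs + countSubsets Q? xs ∎
  where
  open ≡-Reasoning
  ms : List (Vec Bool (length xs))
  ms = allMasks (length xs)
  R : ∀ m → Dec (Q (select (x ∷ xs) m))
  R m = Q? (select (x ∷ xs) m)

countSubsets-≤ : ∀ {A : Set} {Q : List A → Set} (Q? : ∀ F → Dec (Q F))
  {P : A → Set} (P? : ∀ x → Dec (P x)) (xs : List A) → (∀ F → Q F → All P F) → countSubsets Q? xs ≤ 2 ^ length (filter P? xs)
countSubsets-≤ Q? P? [] _ = length-filter (λ m → Q? (select [] m)) ([] ∷ [])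
countSubsets-≤ Q? P? (x ∷ xs) Q⇒P with P? x
... | yes px = begin
  countSubsets Q? (x ∷ xs)
    ≡⟨ countSubsets-∷ Q? x xs ⟩
  countSubsets (λ F → Q? (x ∷ F)) xs + countSubsets Q? xs
    ≤⟨ +-mono-≤ (countSubsets-≤ (λ F → Q? (x ∷ F)) P? xs (λ F q → All.tail (Q⇒P (x ∷ F) q)))
                (≤-trans (countSubsets-≤ Q? P? xs Q⇒P) (m≤m+n _ 0)) ⟩
  2 ^ suc (length (filter P? xs)) ∎
  where open ≤-Reasoning
... | no ¬px = begin
  countSubsets Q? (x ∷ xs)
    ≡⟨ countSubsets-∷ Q? x xs ⟩
  countSubsets (λ F → Q? (x ∷ F)) xs + countSubsets Q? xs
    ≡⟨ cong (λ F → length F + countSubsets Q? xs) (filter-none (λ m → Q? (x ∷ select xs m))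
            (All.universal (λ m q → ¬px (All.head (Q⇒P _ q))) (allMasks (length xs)))) ⟩
  countSubsets Q? xs
    ≤⟨ countSubsets-≤ Q? P? xs Q⇒P ⟩
  2 ^ length (filter P? xs) ∎
  where open ≤-Reasoning

countSubsets-≥ : ∀ {A : Set} {Q : List A → Set} (Q? : ∀ F → Dec (Q F)) {S xs : List A} →
  S ⊆ xs → (∀ m → Q (select S m)) → 2 ^ length S ≤ countSubsets Q? xs
countSubsets-≥ Q? [] Q-all =
  ≤-reflexive (cong length (sym (filter-accept (λ m → Q? (select [] m)) (Q-all []))))
countSubsets-≥ Q? {S} {x ∷ xs} (x ∷ʳ S⊆xs) Q-all = begin
  2 ^ length S                                            ≤⟨ countSubsets-≥ Q? S⊆xs Q-all ⟩
  countSubsets Q? xs                                      ≤⟨ m≤n+m _ _ ⟩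
  countSubsets (λ F → Q? (x ∷ F)) xs + countSubsets Q? xs ≡⟨ countSubsets-∷ Q? x xs ⟨
  countSubsets Q? (x ∷ xs)                                ∎
  where open ≤-Reasoning
countSubsets-≥ Q? {x ∷ S} {x ∷ xs} (refl ∷ S⊆xs) Q-all = begin
  2 ^ suc (length S)
    ≤⟨ +-mono-≤ (countSubsets-≥ (λ F → Q? (x ∷ F)) S⊆xs (λ m → Q-all (true ∷ m)))
                (≤-trans (≤-reflexive (+-identityʳ _))
                         (countSubsets-≥ Q? S⊆xs (λ m → Q-all (false ∷ m)))) ⟩
  countSubsets (λ F → Q? (x ∷ F)) xs + countSubsets Q? xs ≡⟨ countSubsets-∷ Q? x xs ⟨
  countSubsets Q? (x ∷ xs)                                ∎
  where open ≤-Reasoning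

degIn-select-≤ : ∀ {n} (F : List (Edge n)) m v → degIn (select F m) v ≤ degIn F v
degIn-select-≤ []      []          v = z≤n
degIn-select-≤ (e ∷ F) (true ∷ m)  v rewrite degIn-∷ e (select F m) v | degIn-∷ e F v =
  +-monoʳ-≤ _ (degIn-select-≤ F m v)
degIn-select-≤ (e ∷ F) (false ∷ m) v rewrite degIn-∷ e F v =
  ≤-trans (degIn-select-≤ F m v) (m≤n+m _ _)

IsFix-select : ∀ {n} (G : Graph n) {F} → IsFix G F → ∀ m → IsFix G (select F m)
IsFix-select G {F} fix m v = ≤-trans (*-monoʳ-≤ 2 (degIn-select-≤ F m v)) (fix v)

IsFix⇒leaf-unused : ∀ {n} (G : Graph n) {F} → IsFix G F → ∀ v → deg G v ≡ 1 → degIn F v ≡ 0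
IsFix⇒leaf-unused G {F} fix v leaf =
  n<1⇒n≡0 (*-cancelˡ-< 2 (degIn F v) 1 (s≤s (subst (2 * degIn F v ≤_) leaf (fix v))))

IsFix⇒¬LeafEdge : ∀ {n} (G : Graph n) {F} → IsFix G F → ∀ {e} → e ∈ F → ¬ LeafEdge G e
IsFix⇒¬LeafEdge G {F} fix {a , b} e∈F (inj₁ leaf) =
  <⇒≢ (∈⇒0<degIn {E = F} a e∈F (incident-left a b)) (sym (IsFix⇒leaf-unused G {F} fix a leaf))
IsFix⇒¬LeafEdge G {F} fix {a , b} e∈F (inj₂ leaf) =
  <⇒≢ (∈⇒0<degIn {E = F} b e∈F (incident-right a b)) (sym (IsFix⇒leaf-unused G {F} fix b leaf))

∸-∸1 : ∀ m n → m ∸ n ∸ 1 ≡ m ∸ suc n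
∸-∸1 m n = trans (∸-+-assoc m n 1) (cong (m ∸_) (+-comm n 1))

numFix-tree-≤ : ∀ {n} → 3 ≤ n → (T : Graph n) → IsTree T → ∀ {Δ} → IsMaxDegree T Δ →
  numFix T ≤ 2 ^ (n ∸ Δ ∸ 1)
numFix-tree-≤ {suc (suc (suc k))} (s≤s (s≤s (s≤s z≤n))) T tree@(conn , size) {Δ} (_ , v₀ , deg≡Δ) =
  begin
  numFix T
    ≤⟨ countSubsets-≤ (isFix? T) (∁? (leafEdge? T)) E
                      (λ F fix → All.tabulate (IsFix⇒¬LeafEdge T fix)) ⟩
  2 ^ length (filter (∁? (leafEdge? T)) E)
    ≤⟨ ^-monoʳ-≤ 2 inner-edges ⟩
  2 ^ (3 + k ∸ Δ ∸ 1) ∎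
  where
  open ≤-Reasoning
  E : List (Edge (3 + k))
  E = edges T
  leafEdges : ℕ
  leafEdges = length (filter (leafEdge? T) E)
  Δ≤leafEdges : Δ ≤ leafEdges
  Δ≤leafEdges =
    ≤-trans (subst (_≤ leaves T) deg≡Δ (deg≤leaves T tree v₀)) (leaves≤leafEdges T conn)
  inner-edges : length (filter (∁? (leafEdge? T)) E) ≤ 3 + k ∸ Δ ∸ 1
  inner-edges = begin
    length (filter (∁? (leafEdge? T)) E) ≡⟨ m+n∸m≡n leafEdges _ ⟨
    leafEdges + _ ∸ leafEdges            ≡⟨ cong (_∸ leafEdges) (length-filter-∁ (leafEdge? T) E) ⟩
    length E ∸ leafEdges                 ≤⟨ ∸-monoʳ-≤ (length E) Δ≤leafEdges ⟩
    length E ∸ Δ                         ≡⟨ cong (_∸ Δ) size ⟩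
    3 + k ∸ suc Δ                        ≡⟨ ∸-∸1 (3 + k) Δ ⟨
    3 + k ∸ Δ ∸ 1                        ∎

shift : ∀ {n} → Edge n → Edge (suc n)
shift e = suc (proj₁ e) , suc (proj₂ e)

shift-injective : ∀ {n} {e e′ : Edge n} → shift e ≡ shift e′ → e ≡ e′
shift-injective {e = _ , _} {_ , _} refl = refl

degIn-shift-zero : ∀ {n} (E : List (Edge n)) → degIn (map shift E) zero ≡ 0
degIn-shift-zero []      = refl
degIn-shift-zero (_ ∷ E) = degIn-shift-zero E

degIn-shift-suc : ∀ {n} (E : List (Edge n)) v → degIn (map shift E) (suc v) ≡ degIn E v
degIn-shift-suc []      v = refl
degIn-shift-suc (e ∷ E) v rewrite degIn-shift-suc E v = refl

point : Graph 1
point = record { edges = [] ; ordered = [] ; distinct = [] }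

point-isTree : IsTree point
point-isTree = (λ { zero zero → ε }) , refl

attach : ∀ {n} → Graph n → Fin n → Graph (suc n)
attach G u = record
  { edges    = (zero , suc u) ∷ map shift (edges G)
  ; ordered  = s≤s z≤n ∷ Allₚ.map⁺ (All.map s≤s (ordered G))
  ; distinct = Allₚ.map⁺ (All.universal (λ _ ()) (edges G))
               ∷ Uniqueₚ.map⁺ shift-injective (distinct G)
  }

deg-attach-zero : ∀ {n} (G : Graph n) u → deg (attach G u) zero ≡ 1
deg-attach-zero G u = cong suc (degIn-shift-zero (edges G))

indicator-≟-refl : ∀ {n} (u : Fin n) → indicator (does (u ≟ u)) ≡ 1
indicator-≟-refl u = cong indicator (dec-true (u ≟ u) refl)

indicator-≟-≢ : ∀ {n} {v u : Fin n} → v ≢ u → indicator (does (v ≟ u)) ≡ 0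
indicator-≟-≢ {v = v} {u} v≢u = cong indicator (dec-false (v ≟ u) v≢u)

deg-attach-suc : ∀ {n} (G : Graph n) u v → deg (attach G u) (suc v) ≡ indicator (does (v ≟ u)) + deg G v
deg-attach-suc G u v = trans (degIn-∷ (zero , suc u) (map shift (edges G)) (suc v))
                             (cong (indicator (does (v ≟ u)) +_) (degIn-shift-suc (edges G) v))

deg-attach-suc-≢ : ∀ {n} (G : Graph n) u {v} → v ≢ u → deg (attach G u) (suc v) ≡ deg G v
deg-attach-suc-≢ G u {v} v≢u = trans (deg-attach-suc G u v) (cong (_+ deg G v) (indicator-≟-≢ v≢u))

deg-attach-suc-≡ : ∀ {n} (G : Graph n) u → deg (attach G u) (suc u) ≡ suc (deg G u)
deg-attach-suc-≡ G u = trans (deg-attach-suc G u u) (cong (_+ deg G u) (indicator-≟-refl u))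

Star-attach : ∀ {n} (G : Graph n) u {x y} → Star (Adj G) x y → Star (Adj (attach G u)) (suc x) (suc y)
Star-attach G u = Star.gmap suc λ where
  (inj₁ xy∈G) → inj₁ (there (∈-map⁺ shift xy∈G))
  (inj₂ yx∈G) → inj₂ (there (∈-map⁺ shift yx∈G))

attach-connected : ∀ {n} (G : Graph n) u → Connected G → Connected (attach G u)
attach-connected G u conn zero    zero    = ε
attach-connected G u conn zero    (suc w) = inj₁ (here refl) ◅ Star-attach G u (conn u w)
attach-connected G u conn (suc v) zero    = Star-attach G u (conn v u) Star.◅◅ (inj₂ (here refl) ◅ ε)
attach-connected G u conn (suc v) (suc w) = Star-attach G u (conn v w)

attach-isTree : ∀ {n} (G : Graph n) u → IsTree G → IsTree (attach G u)
attach-isTree {suc n} G u (conn , size) =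
  attach-connected G u conn , cong suc (trans (length-map shift (edges G)) size)

-- spider l k: a centre (hub l k) with l pendant leaves and k legs of length two; legs l k are
-- the k edges from the centre to the middle vertices of the legs.  Each attach adds the new
-- vertex as 0 and renumbers the old ones by suc.
hub : ∀ l k → Fin (k * 2 + suc l)
hub l       (suc k) = suc (suc (hub l k))
hub zero    zero    = zero
hub (suc l) zero    = suc (hub l zero)

spider : ∀ l k → Graph (k * 2 + suc l)
spider l       (suc k) = attach (attach (spider l k) (hub l k)) zero
spider zero    zero    = point
spider (suc l) zero    = attach (spider l zero) (hub l zero)

legs : ∀ l k → List (Edge (k * 2 + suc l))
legs l zero    = []
legs l (suc k) = (suc zero , suc (suc (hub l k))) ∷ map shift (map shift (legs l k))

spider-isTree : ∀ l k → IsTree (spider l k)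
spider-isTree l       (suc k) =
  attach-isTree (attach (spider l k) (hub l k)) zero (attach-isTree (spider l k) (hub l k) (spider-isTree l k))
spider-isTree zero    zero    = point-isTree
spider-isTree (suc l) zero    = attach-isTree (spider l zero) (hub l zero) (spider-isTree l zero)

deg-spider-suc² : ∀ l k v →
  deg (spider l (suc k)) (suc (suc v)) ≡ indicator (does (v ≟ hub l k)) + deg (spider l k) v
deg-spider-suc² l k v = trans (deg-attach-suc-≢ (attach (spider l k) (hub l k)) zero (λ ()))
                              (deg-attach-suc (spider l k) (hub l k) v)

deg-spider-middle : ∀ l k → deg (spider l (suc k)) (suc zero) ≡ 2
deg-spider-middle l k = trans (deg-attach-suc-≡ (attach (spider l k) (hub l k)) zero)
                              (cong suc (deg-attach-zero (spider l k) (hub l k)))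

degIn-legs-suc² : ∀ l k v →
  degIn (legs l (suc k)) (suc (suc v)) ≡ indicator (does (v ≟ hub l k)) + degIn (legs l k) v
degIn-legs-suc² l k v = begin
  degIn (legs l (suc k)) (suc (suc v))
    ≡⟨ degIn-∷ (suc zero , suc (suc (hub l k))) (map shift (map shift (legs l k))) (suc (suc v)) ⟩
  indicator (does (v ≟ hub l k)) + degIn (map shift (map shift (legs l k))) (suc (suc v))
    ≡⟨ cong (indicator (does (v ≟ hub l k)) +_)
            (trans (degIn-shift-suc (map shift (legs l k)) (suc v)) (degIn-shift-suc (legs l k) v)) ⟩
  indicator (does (v ≟ hub l k)) + degIn (legs l k) v ∎
  where open ≡-Reasoning

degIn-legs-middle : ∀ l k → degIn (legs l (suc k)) (suc zero) ≡ 1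
degIn-legs-middle l k =
  cong suc (trans (degIn-shift-suc (map shift (legs l k)) zero) (degIn-shift-zero (legs l k)))

deg-hub : ∀ l k → deg (spider l k) (hub l k) ≡ l + k
deg-hub l       (suc k) = begin
  deg (spider l (suc k)) (suc (suc (hub l k)))
    ≡⟨ deg-spider-suc² l k (hub l k) ⟩
  indicator (does (hub l k ≟ hub l k)) + deg (spider l k) (hub l k)
    ≡⟨ cong₂ _+_ (indicator-≟-refl (hub l k)) (deg-hub l k) ⟩
  suc (l + k)
    ≡⟨ +-suc l k ⟨
  l + suc k ∎
  where open ≡-Reasoning
deg-hub zero    zero    = refl
deg-hub (suc l) zero    = trans (deg-attach-suc-≡ (spider l zero) (hub l zero)) (cong suc (deg-hub l zero))

degIn-legs-hub : ∀ l k → degIn (legs l k) (hub l k) ≡ k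
degIn-legs-hub l zero    = refl
degIn-legs-hub l (suc k) =
  trans (degIn-legs-suc² l k (hub l k)) (cong₂ _+_ (indicator-≟-refl (hub l k)) (degIn-legs-hub l k))

suc-≢ : ∀ {n} {x y : Fin n} → Fin.suc x ≢ suc y → x ≢ y
suc-≢ sx≢sy refl = sx≢sy refl

deg-nonhub≤2 : ∀ l k v → v ≢ hub l k → deg (spider l k) v ≤ 2
deg-nonhub≤2 l (suc k) zero          _     =
  ≤-trans (≤-reflexive (deg-attach-zero (attach (spider l k) (hub l k)) zero)) (s≤s z≤n)
deg-nonhub≤2 l (suc k) (suc zero)    _     = ≤-reflexive (deg-spider-middle l k)
deg-nonhub≤2 l (suc k) (suc (suc v)) v≢hub = begin
  deg (spider l (suc k)) (suc (suc v))                ≡⟨ deg-spider-suc² l k v ⟩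
  indicator (does (v ≟ hub l k)) + deg (spider l k) v ≡⟨ cong (_+ deg (spider l k) v) (indicator-≟-≢ v≢hub′) ⟩
  deg (spider l k) v                                  ≤⟨ deg-nonhub≤2 l k v v≢hub′ ⟩
  2                                                   ∎
  where
  open ≤-Reasoning
  v≢hub′ : v ≢ hub l k
  v≢hub′ = suc-≢ (suc-≢ v≢hub)
deg-nonhub≤2 zero    zero zero    0≢0   = contradiction refl 0≢0
deg-nonhub≤2 (suc l) zero zero    _     =
  ≤-trans (≤-reflexive (deg-attach-zero (spider l zero) (hub l zero))) (s≤s z≤n)
deg-nonhub≤2 (suc l) zero (suc v) v≢hub =
  ≤-trans (≤-reflexive (deg-attach-suc-≢ (spider l zero) (hub l zero) (suc-≢ v≢hub)))
          (deg-nonhub≤2 l zero v (suc-≢ v≢hub))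

legs-nonhub : ∀ l k v → v ≢ hub l k → 2 * degIn (legs l k) v ≤ deg (spider l k) v
legs-nonhub l zero    v             _     = z≤n
legs-nonhub l (suc k) zero          _     =
  ≤-trans (≤-reflexive (cong (2 *_) (degIn-shift-zero (map shift (legs l k))))) z≤n
legs-nonhub l (suc k) (suc zero)    _     =
  ≤-reflexive (trans (cong (2 *_) (degIn-legs-middle l k)) (sym (deg-spider-middle l k)))
legs-nonhub l (suc k) (suc (suc v)) v≢hub = begin
  2 * degIn (legs l (suc k)) (suc (suc v))                  ≡⟨ cong (2 *_) (degIn-legs-suc² l k v) ⟩
  2 * (indicator (does (v ≟ hub l k)) + degIn (legs l k) v) ≡⟨ cong (λ i → 2 * (i + degIn (legs l k) v)) not-hub ⟩
  2 * degIn (legs l k) v                                    ≤⟨ legs-nonhub l k v v≢hub′ ⟩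
  deg (spider l k) v                                        ≡⟨ cong (_+ deg (spider l k) v) not-hub ⟨
  indicator (does (v ≟ hub l k)) + deg (spider l k) v       ≡⟨ deg-spider-suc² l k v ⟨
  deg (spider l (suc k)) (suc (suc v))                      ∎
  where
  open ≤-Reasoning
  v≢hub′ : v ≢ hub l k
  v≢hub′ = suc-≢ (suc-≢ v≢hub)
  not-hub : indicator (does (v ≟ hub l k)) ≡ 0
  not-hub = indicator-≟-≢ v≢hub′

spider-maxDegree : ∀ l k → 2 ≤ l + k → IsMaxDegree (spider l k) (l + k)
spider-maxDegree l k 2≤l+k = bounded , hub l k , deg-hub l k
  where
  bounded : ∀ v → deg (spider l k) v ≤ l + k
  bounded v with v ≟ hub l k
  ... | yes refl  = ≤-reflexive (deg-hub l k)
  ... | no v≢hub = ≤-trans (deg-nonhub≤2 l k v v≢hub) 2≤l+k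

legs-isFix : ∀ l k → k ≤ l → IsFix (spider l k) (legs l k)
legs-isFix l k k≤l v with v ≟ hub l k
... | no v≢hub = legs-nonhub l k v v≢hub
... | yes refl  = begin
  2 * degIn (legs l k) (hub l k) ≡⟨ cong (2 *_) (degIn-legs-hub l k) ⟩
  2 * k                          ≡⟨ cong (k +_) (+-identityʳ k) ⟩
  k + k                          ≤⟨ +-monoˡ-≤ k k≤l ⟩
  l + k                          ≡⟨ deg-hub l k ⟨
  deg (spider l k) (hub l k)     ∎
  where open ≤-Reasoning

legs-⊆ : ∀ l k → legs l k ⊆ edges (spider l k)
legs-⊆ l zero    = minimum _
legs-⊆ l (suc k) = _ ∷ʳ (refl ∷ Sublistₚ.map⁺ shift (Sublistₚ.map⁺ shift (legs-⊆ l k)))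

length-legs : ∀ l k → length (legs l k) ≡ k
length-legs l zero    = refl
length-legs l (suc k) = cong suc (begin
  length (map shift (map shift (legs l k))) ≡⟨ length-map shift (map shift (legs l k)) ⟩
  length (map shift (legs l k))             ≡⟨ length-map shift (legs l k) ⟩
  length (legs l k)                         ≡⟨ length-legs l k ⟩
  k                                         ∎)
  where open ≡-Reasoning

spider-numFix-≥ : ∀ l k → k ≤ l → 2 ^ k ≤ numFix (spider l k)
spider-numFix-≥ l k k≤l = subst (λ m → 2 ^ m ≤ numFix (spider l k)) (length-legs l k)
  (countSubsets-≥ (isFix? (spider l k)) (legs-⊆ l k)
                  (IsFix-select (spider l k) {legs l k} (legs-isFix l k k≤l)))

ceil3-bound : ∀ n {Δ} → n ∸ ceil3 n ≤ Δ → 2 * n ≤ 3 * Δ + 2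
ceil3-bound n {Δ} n∸q≤Δ = +-cancelˡ-≤ n _ _ (begin
  3 * n           ≤⟨ *-monoʳ-≤ 3 (≤-trans (m≤n+m∸n n q) (+-monoʳ-≤ q n∸q≤Δ)) ⟩
  3 * (q + Δ)     ≡⟨ regroupˡ q Δ ⟩
  q * 3 + 3 * Δ   ≤⟨ +-monoˡ-≤ (3 * Δ) (m/n*n≤m (n + 2) 3) ⟩
  n + 2 + 3 * Δ   ≡⟨ regroupʳ n Δ ⟩
  n + (3 * Δ + 2) ∎)
  where
  open ≤-Reasoning
  q : ℕ
  q = ceil3 n
  regroupˡ : ∀ q Δ → 3 * (q + Δ) ≡ q * 3 + 3 * Δ
  regroupˡ = solve-∀
  regroupʳ : ∀ n Δ → n + 2 + 3 * Δ ≡ n + (3 * Δ + 2)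
  regroupʳ = solve-∀

spider-parameters : ∀ {n Δ} → 4 ≤ suc n → suc n ∸ ceil3 (suc n) ≤ Δ → Δ ≤ n →
  let k = n ∸ Δ ; l = Δ ∸ k in l + k ≡ Δ × k ≤ l × 2 ≤ Δ × k * 2 + suc l ≡ suc n
spider-parameters {n} {Δ} 4≤n lo Δ≤n = l+k≡Δ , k≤l , 2≤Δ , size
  where
  k l : ℕ
  k = n ∸ Δ
  l = Δ ∸ k
  bound : 2 * suc n ≤ 3 * Δ + 2
  bound = ceil3-bound (suc n) lo
  k+Δ≡n : k + Δ ≡ n
  k+Δ≡n = m∸n+n≡m Δ≤n
  2k≤Δ : 2 * k ≤ Δ
  2k≤Δ = +-cancelʳ-≤ (2 + 2 * Δ) (2 * k) Δ (begin
    2 * k + (2 + 2 * Δ) ≡⟨ regroupˡ k Δ ⟩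
    2 * suc (k + Δ)     ≡⟨ cong (λ m → 2 * suc m) k+Δ≡n ⟩
    2 * suc n           ≤⟨ bound ⟩
    3 * Δ + 2           ≡⟨ regroupʳ Δ ⟩
    Δ + (2 + 2 * Δ)     ∎)
    where
    open ≤-Reasoning
    regroupˡ : ∀ k Δ → 2 * k + (2 + 2 * Δ) ≡ 2 * suc (k + Δ)
    regroupˡ = solve-∀
    regroupʳ : ∀ Δ → 3 * Δ + 2 ≡ Δ + (2 + 2 * Δ)
    regroupʳ = solve-∀
  k≤l : k ≤ l
  k≤l = m+n≤o⇒m≤o∸n k (subst (_≤ Δ) (cong (k +_) (+-identityʳ k)) 2k≤Δ)
  l+k≡Δ : l + k ≡ Δ
  l+k≡Δ = m∸n+n≡m (m+n≤o⇒m≤o k 2k≤Δ)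
  2≤Δ : 2 ≤ Δ
  2≤Δ = *-cancelˡ-≤ 3 (+-cancelʳ-≤ 2 6 (3 * Δ) (≤-trans (*-monoʳ-≤ 2 4≤n) bound))
  size : k * 2 + suc l ≡ suc n
  size = begin
    k * 2 + suc l   ≡⟨ regroup k l ⟩
    suc (l + k + k) ≡⟨ cong (λ m → suc (m + k)) l+k≡Δ ⟩
    suc (Δ + k)     ≡⟨ cong suc (trans (+-comm Δ k) k+Δ≡n) ⟩
    suc n           ∎
    where
    open ≡-Reasoning
    regroup : ∀ k l → k * 2 + suc l ≡ suc (l + k + k)
    regroup = solve-∀

spider-realising : ∀ {n} l k {Δ} → l + k ≡ Δ → k ≤ l → 2 ≤ Δ → k * 2 + suc l ≡ n →
  Σ (Graph n) (λ T → IsTree T × IsMaxDegree T Δ × 2 ^ k ≤ numFix T)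
spider-realising l k refl k≤l 2≤Δ refl =
  spider l k , spider-isTree l k , spider-maxDegree l k 2≤Δ , spider-numFix-≥ l k k≤l

lemma14 : ((n : ℕ) → 4 ≤ n → (T : Graph n) → IsTree T → (Δ : ℕ) → IsMaxDegree T Δ →
      n ∸ ceil3 n ≤ Δ → numFix T ≤ 2 ^ (n ∸ Δ ∸ 1))
    ×
    ((n : ℕ) → 4 ≤ n → (Δ : ℕ) → n ∸ ceil3 n ≤ Δ → Δ ≤ n ∸ 1 →
      Σ (Graph n) (λ T → IsTree T × IsMaxDegree T Δ × (numFix T ≡ 2 ^ (n ∸ Δ ∸ 1))))
lemma14 = (λ n 4≤n T tree Δ maxDeg _ → numFix-tree-≤ (≤-trans (n≤1+n 3) 4≤n) T tree maxDeg)
        , sharp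
  where
  sharp : (n : ℕ) → 4 ≤ n → (Δ : ℕ) → n ∸ ceil3 n ≤ Δ → Δ ≤ n ∸ 1 →
    Σ (Graph n) (λ T → IsTree T × IsMaxDegree T Δ × (numFix T ≡ 2 ^ (n ∸ Δ ∸ 1)))
  sharp (suc n) 4≤n Δ lo Δ≤n with spider-parameters 4≤n lo Δ≤n
  ... | l+k≡Δ , k≤l , 2≤Δ , size with spider-realising _ _ l+k≡Δ k≤l 2≤Δ size
  ... | T , tree , maxDeg , lower =
    T , tree , maxDeg , ≤-antisym (numFix-tree-≤ (≤-trans (n≤1+n 3) 4≤n) T tree maxDeg)
                                  (subst (λ m → 2 ^ m ≤ numFix T) (sym (∸-∸1 (suc n) Δ)) lower)
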